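{- For $m\geq 1$ and $0\le i\le m$ let $$T(m,i)=\frac{4m^2+7m+3+i\sqrt{4m+4i^2+1}-2i^2}{2(m-i+1)(m+1)}.$$ Then for all $m\geq 2$ and $1\leq i\leq m-1$, $$\frac{d_i(m+1)}{d_i(m)}<T(m,i),$$ and for all $m\geq 1$, $$\frac{d_0(m+1)}{d_0(m)}=T(m,0),\qquad \frac{d_m(m+1)}{d_m(m)}=T(m,m).$$
   Context: For integers $m\geq 0$, the Boros-Moll polynomial is $P_m(a)=2^{ -2m}\sum_{k}2^k\binom{2m-2k}{m-k}\binom{m+k}{k}(a+1)^k=\sum_{i=0}^m d_i(m)a^i$, so that $d_i(m)=2^{ -2m}\sum_{k=0}^m 2^k\binom{2m-2k}{m-k}\binom{m+k}{m}\binom{k}{i}$ for $0\le i\le m$. These coefficients are positive. -}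

module Defs where

open import Data.Nat as ℕ using (ℕ; zero; suc; _^_)
open import Data.Nat.Properties using (m^n≢0)
open import Data.Nat.Combinatorics using (_C_)
open import Data.Integer as ℤ using (ℤ; +_; +[1+_]; -[1+_])
open import Data.Rational using (ℚ; mkℚ; _+_; _*_; _-_; _÷_; _<_; _≤_; 0ℚ; _/_)
open import Data.Sum using (_⊎_)
open import Data.Product using (_×_)
open import Relation.Binary.PropositionalEquality using (_≡_)

Σ≤ : ℕ → (ℕ → ℕ) → ℕ
Σ≤ zero    f = f 0
Σ≤ (suc n) f = Σ≤ n f ℕ.+ f (suc n)

-- 2^{2m} d_i(m) = Σ_{k=0}^m 2^k C(2m-2k, m-k) C(m+k, m) C(k, i)
dNum : ℕ → ℕ → ℕ
dNum m i = Σ≤ m (λ k → 2 ^ k ℕ.* ((2 ℕ.* m ℕ.∸ 2 ℕ.* k) C (m ℕ.∸ k))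
                         ℕ.* ((m ℕ.+ k) C m) ℕ.* (k C i))

d : ℕ → ℕ → ℚ
d m i = (+ dNum m i / (2 ^ (2 ℕ.* m))) {{m^n≢0 2 (2 ℕ.* m)}}

ℕtoℚ : ℕ → ℚ
ℕtoℚ n = + n / 1

-- Division of rationals, totalised by x ÷₀ 0 = 0 (only ever used with a
-- nonzero divisor in the theorem, since d_i(m) > 0 and the denominators of T are ≥ 1).
_÷₀_ : ℚ → ℚ → ℚ
x ÷₀ mkℚ (+ zero)   _ _ = 0ℚ
x ÷₀ q@(mkℚ +[1+ _ ] _ _) = x ÷ q
x ÷₀ q@(mkℚ -[1+ _ ] _ _) = x ÷ q

-- Comparisons with quadratic surds a + b·√D  (b ≥ 0, D ∈ ℕ, √D the nonnegative
-- square root), expressed without real numbers: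
--   x < a + b√D  ⇔  x - a < 0  or  (x - a)² < b² D
--   x = a + b√D  ⇔  0 ≤ x - a  and (x - a)² = b² D
_<Surd[_+_√_] : ℚ → ℚ → ℚ → ℕ → Set
x <Surd[ a + b √ D ] = (x - a < 0ℚ) ⊎ ((x - a) * (x - a) < b * b * ℕtoℚ D)

_≡Surd[_+_√_] : ℚ → ℚ → ℚ → ℕ → Set
x ≡Surd[ a + b √ D ] = (0ℚ ≤ x - a) × ((x - a) * (x - a) ≡ b * b * ℕtoℚ D)

-- T(m,i) = (A + i√D) / B with
--   A = 4m²+7m+3-2i²,  B = 2(m-i+1)(m+1),  D = 4m+4i²+1.
-- Represented as T(m,i) = TA m i + TB m i · √(TD m i).
TAnum : ℕ → ℕ → ℚ
TAnum m i = ℕtoℚ (4 ℕ.* m ℕ.* m ℕ.+ 7 ℕ.* m ℕ.+ 3) - ℕtoℚ (2 ℕ.* i ℕ.* i)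

TDen : ℕ → ℕ → ℚ
TDen m i = ℕtoℚ (2 ℕ.* (m ℕ.∸ i ℕ.+ 1) ℕ.* (m ℕ.+ 1))

TA : ℕ → ℕ → ℚ
TA m i = TAnum m i ÷₀ TDen m i

TB : ℕ → ℕ → ℚ
TB m i = ℕtoℚ i ÷₀ TDen m i

TD : ℕ → ℕ → ℕ
TD m i = 4 ℕ.* m ℕ.+ 4 ℕ.* i ℕ.* i ℕ.+ 1

ratio : ℕ → ℕ → ℚ
ratio m i = d (suc m) i ÷₀ d m i

{-# OPTIONS --safe #-}
-- Write N(m,i) = dNum m i = 4^m d_i(m) ∈ ℕ, so that the ratio is N(m+1,i) / (4 N(m,i)), and T = (A + i√D)/B.
-- The claim is a statement about the excess u(m) = B N(m+1,i) − 4 A N(m,i): it says u < 4 i √D N(m,i),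
-- with equality for i = 0 and i = m. Summing termwise recurrences of the weights
-- 2^k C(2m−2k,m−k) C(m+k,m) gives recurrences of N in i (one of them through a telescoping sum),
-- and eliminating the neighbouring values of i yields a three-term recurrence in m for fixed i.
-- In terms of the excess it reads B(m) u(m+1) = 4 P u(m) + 16 Q N(m,i) with P, Q ≥ 0. At m = i
-- one has D = (2i+1)² and u = 4 i (2i+1) N, which gives the equality case, and an induction on
-- m − i propagates u² ≤ 16 i² D N² and makes it strict as soon as m > i, the step being a
-- polynomial inequality with an explicit certificate.
module Submission where

open import Defs

module Numerators where

  open import Data.Nat
  open import Data.Nat.Properties
  open import Data.Nat.Combinatorics using (_C_; nCk+nC[k+1]≡[n+1]C[k+1]; nC1≡n; nCn≡1; k>n⇒nCk≡0)
  open import Data.Nat.Tactic.RingSolver using (solve)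
  open import Data.List using ([]; _∷_)
  open import Data.Product using (Σ-syntax; _×_; _,_; proj₁; proj₂)
  open import Data.Sum using (inj₁; inj₂)
  open import Relation.Binary.PropositionalEquality
  open import Algebra.Properties.CommutativeSemigroup +-commutativeSemigroup
    using () renaming (interchange to +-interchange)

  -- The ring solver proves identities only; a consequence L ≡ R of hypotheses lₖ ≡ rₖ is
  -- obtained by solving L + Σ cₖ * rₖ ≡ R + Σ cₖ * lₖ, the hypotheses being combined by _⊕_ and _·_.
  linear-combination : ∀ {L R X Y : ℕ} → X ≡ Y → L + Y ≡ R + X → L ≡ R
  linear-combination {L} {R} X≡Y e = +-cancelʳ-≡ _ L R (trans e (cong (R +_) X≡Y))

  infixl 4 _⊕_
  infix  5 _·_

  _⊕_ : ∀ {a b c d : ℕ} → a ≡ b → c ≡ d → a + c ≡ b + d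
  _⊕_ = cong₂ _+_

  _·_ : ∀ (c : ℕ) {a b : ℕ} → a ≡ b → c * a ≡ c * b
  c · h = cong (c *_) h

  by-difference : {P : ℕ → ℕ → Set} → (∀ k s → P k (k + s)) → ∀ {k m} → k ≤ m → P k m
  by-difference h k≤m with m≤n⇒∃[o]m+o≡n k≤m
  ... | s , refl = h _ s

  Σ≤-cong : ∀ n {f g : ℕ → ℕ} → (∀ {k} → k ≤ n → f k ≡ g k) → Σ≤ n f ≡ Σ≤ n g
  Σ≤-cong zero    f≗g = f≗g z≤n
  Σ≤-cong (suc n) f≗g = Σ≤-cong n (λ k≤n → f≗g (m≤n⇒m≤1+n k≤n)) ⊕ f≗g ≤-refl

  Σ≤-distrib-+ : ∀ n (f g : ℕ → ℕ) → Σ≤ n (λ k → f k + g k) ≡ Σ≤ n f + Σ≤ n g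
  Σ≤-distrib-+ zero    f g = refl
  Σ≤-distrib-+ (suc n) f g = trans (cong (_+ (f (suc n) + g (suc n))) (Σ≤-distrib-+ n f g))
                                    (+-interchange (Σ≤ n f) (Σ≤ n g) (f (suc n)) (g (suc n)))

  Σ≤-distribˡ-* : ∀ n a (f : ℕ → ℕ) → Σ≤ n (λ k → a * f k) ≡ a * Σ≤ n f
  Σ≤-distribˡ-* zero    a f = refl
  Σ≤-distribˡ-* (suc n) a f = trans (cong (_+ a * f (suc n)) (Σ≤-distribˡ-* n a f))
                                     (sym (*-distribˡ-+ a (Σ≤ n f) (f (suc n))))

  Σ≤-shift : ∀ n (f : ℕ → ℕ) → Σ≤ (suc n) f ≡ f 0 + Σ≤ n (λ k → f (suc k))
  Σ≤-shift zero    f = refl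
  Σ≤-shift (suc n) f = trans (cong (_+ f (2 + n)) (Σ≤-shift n f)) (+-assoc (f 0) _ _)

  Σ≤-zero : ∀ n (f : ℕ → ℕ) → (∀ {k} → k ≤ n → f k ≡ 0) → Σ≤ n f ≡ 0
  Σ≤-zero zero    f f≡0 = f≡0 z≤n
  Σ≤-zero (suc n) f f≡0 = Σ≤-zero n f (λ k≤n → f≡0 (m≤n⇒m≤1+n k≤n)) ⊕ f≡0 ≤-refl

  f[n]≤Σ≤ : ∀ n (f : ℕ → ℕ) → f n ≤ Σ≤ n f
  f[n]≤Σ≤ zero    f = ≤-refl
  f[n]≤Σ≤ (suc n) f = m≤n+m (f (suc n)) (Σ≤ n f)

  C-pascal : ∀ n k → suc n C suc k ≡ n C k + n C suc k
  C-pascal n k = sym (nCk+nC[k+1]≡[n+1]C[k+1] n k)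

  C-absorb : ∀ n k → suc k * (suc n C suc k) ≡ suc n * (n C k)
  C-absorb zero    zero    = refl
  C-absorb zero    (suc k) = *-zeroʳ (2 + k)
  C-absorb (suc n) zero    = trans (*-identityˡ _) (trans (nC1≡n (2 + n)) (sym (*-identityʳ _)))
  C-absorb (suc n) (suc k) = begin
    suc (suc k) * (suc (suc n) C suc (suc k))
      ≡⟨ suc (suc k) · C-pascal (suc n) (suc k) ⟩
    suc (suc k) * (suc n C suc k + suc n C suc (suc k))
      ≡⟨ regroup (suc k) (suc n C suc k) (suc n C suc (suc k)) ⟩
    suc k * (suc n C suc k) + suc n C suc k + suc (suc k) * (suc n C suc (suc k))
      ≡⟨ cong (_+ suc n C suc k) (C-absorb n k) ⊕ C-absorb n (suc k) ⟩
    suc n * (n C k) + suc n C suc k + suc n * (n C suc k)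
      ≡⟨ regroup′ (suc n) (n C k) (n C suc k) (suc n C suc k) ⟩
    suc n * (n C k + n C suc k) + suc n C suc k
      ≡⟨ cong (λ z → suc n * z + suc n C suc k) (sym (C-pascal n k)) ⟩
    suc n * (suc n C suc k) + suc n C suc k
      ≡⟨ +-comm (suc n * (suc n C suc k)) _ ⟩
    suc (suc n) * (suc n C suc k) ∎
    where
    open ≡-Reasoning
    regroup : ∀ a x y → suc a * (x + y) ≡ a * x + x + suc a * y
    regroup a x y = solve (a ∷ x ∷ y ∷ [])
    regroup′ : ∀ a x y z → a * x + z + a * y ≡ a * (x + y) + z
    regroup′ a x y z = solve (a ∷ x ∷ y ∷ z ∷ [])

  C-ratio : ∀ n k → suc k * (n C suc k) + k * (n C k) ≡ n * (n C k)
  C-ratio n k = algebra (C-pascal n k) (C-absorb n k)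
    where
    algebra : ∀ {a b c} → c ≡ a + b → suc k * c ≡ suc n * a → suc k * b + k * a ≡ n * a
    algebra {a} {b} {c} h₁ h₂ =
      linear-combination (suc k · sym h₁ ⊕ 1 · h₂) (solve (n ∷ k ∷ a ∷ b ∷ c ∷ []))

  C-pos : ∀ {n k} → k ≤ n → 0 < n C k
  C-pos {zero}  {zero}  _         = z<s
  C-pos {suc n} {zero}  _         = z<s
  C-pos {suc n} {suc k} (s≤s k≤n) = subst (0 <_) (sym (C-pascal n k)) (<-≤-trans (C-pos k≤n) (m≤m+n _ _))

  C-suc-upper : ∀ m t → suc t * (suc (m + t) C m) ≡ suc (m + t) * ((m + t) C m)
  C-suc-upper m t = algebra (C-ratio (suc (m + t)) m) (C-absorb (m + t) m)
    where
    algebra : ∀ {p q g} → suc m * q + m * p ≡ suc (m + t) * p → suc m * q ≡ suc (m + t) * g →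
              suc t * p ≡ suc (m + t) * g
    algebra {p} {q} {g} h₁ h₂ =
      linear-combination (1 · sym h₁ ⊕ 1 · h₂) (solve (m ∷ t ∷ p ∷ q ∷ g ∷ []))

  centralBinomial : ℕ → ℕ
  centralBinomial s = (2 * s) C s

  centralBinomial-suc : ∀ s → suc s * centralBinomial (suc s) ≡ 2 * (1 + 2 * s) * centralBinomial s
  centralBinomial-suc s = begin
    suc s * ((2 * suc s) C suc s)       ≡⟨ cong (λ n → suc s * (n C suc s)) (*-suc 2 s) ⟩
    suc s * ((2 + 2 * s) C suc s)       ≡⟨ algebra (C-absorb (suc (2 * s)) s) (C-absorb (2 * s) s)
                                                   (C-ratio (suc (2 * s)) s) ⟩
    2 * (1 + 2 * s) * ((2 * s) C s)     ∎
    where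
    open ≡-Reasoning
    algebra : ∀ {b₂ x y b₁} → suc s * b₂ ≡ (2 + 2 * s) * x → suc s * y ≡ (1 + 2 * s) * b₁ →
              suc s * y + s * x ≡ (1 + 2 * s) * x → suc s * b₂ ≡ 2 * (1 + 2 * s) * b₁
    algebra {b₂} {x} {y} {b₁} h₁ h₂ h₃ =
      linear-combination (1 · h₁ ⊕ 2 · h₂ ⊕ 2 · sym h₃) (solve (s ∷ b₂ ∷ x ∷ y ∷ b₁ ∷ []))

  weight : ℕ → ℕ → ℕ
  weight m k = 2 ^ k * ((2 * m ∸ 2 * k) C (m ∸ k)) * ((m + k) C m)

  weight-+ : ∀ k s → weight (k + s) k ≡ 2 ^ k * centralBinomial s * ((k + s + k) C (k + s))
  weight-+ k s = cong (λ z → 2 ^ k * z * ((k + s + k) C (k + s))) (cong₂ _C_ 2[k+s]∸2k≡2s (m+n∸m≡n k s))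
    where
    2[k+s]∸2k≡2s : 2 * (k + s) ∸ 2 * k ≡ 2 * s
    2[k+s]∸2k≡2s = trans (cong (_∸ 2 * k) (*-distribˡ-+ 2 k s)) (m+n∸m≡n (2 * k) (2 * s))

  weight-suc-k : ∀ k s → let m = suc k + s in
                 suc k * (1 + 2 * s) * weight m (suc k) ≡ suc s * (1 + m + k) * weight m k
  weight-suc-k k s = begin
    suc k * (1 + 2 * s) * weight m (suc k)                    ≡⟨ suc k * (1 + 2 * s) · weight-m[1+k] ⟩
    suc k * (1 + 2 * s) * (2 * 2 ^ k * b₀ * (suc (m + k) C m))
      ≡⟨ algebra m (2 ^ k) b₁ b₀ ((m + k) C m) (suc (m + k) C m)
                   (centralBinomial-suc s) (C-suc-upper m k) ⟩
    suc s * (1 + m + k) * (2 ^ k * b₁ * ((m + k) C m))         ≡⟨ suc s * (1 + m + k) · sym weight-m[k] ⟩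
    suc s * (1 + m + k) * weight m k                          ∎
    where
    open ≡-Reasoning
    m  = suc k + s
    b₀ = centralBinomial s
    b₁ = centralBinomial (suc s)
    weight-m[1+k] : weight m (suc k) ≡ 2 * 2 ^ k * b₀ * (suc (m + k) C m)
    weight-m[1+k] = trans (weight-+ (suc k) s) (cong (λ n → 2 * 2 ^ k * b₀ * (n C m)) (+-suc m k))
    weight-m[k] : weight m k ≡ 2 ^ k * b₁ * ((m + k) C m)
    weight-m[k] = subst (λ n → weight n k ≡ 2 ^ k * b₁ * ((n + k) C n)) (+-suc k s) (weight-+ k (suc s))
    algebra : ∀ M p b₁ b₀ g g₁ → suc s * b₁ ≡ 2 * (1 + 2 * s) * b₀ → suc k * g₁ ≡ suc (M + k) * g →
              suc k * (1 + 2 * s) * (2 * p * b₀ * g₁) ≡ suc s * (1 + M + k) * (p * b₁ * g)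
    algebra M p b₁ b₀ g g₁ h₁ h₂ =
      linear-combination (p * g * (1 + M + k) · sym h₁ ⊕ 2 * p * b₀ * (1 + 2 * s) · h₂)
                         (solve (k ∷ s ∷ M ∷ p ∷ b₁ ∷ b₀ ∷ g ∷ g₁ ∷ []))

  weight-suc-m-+ : ∀ t s → let m = t + suc s in
                 2 * suc m * weight (suc m) (suc t)
                   ≡ 4 * ((2 * m + 2 * t + 2) * weight m t + (2 * s + 1) * weight m (suc t))
  weight-suc-m-+ t s = begin
    2 * suc m * weight (suc m) (suc t)                       ≡⟨ 2 * suc m · weight-1+m[1+t] ⟩
    2 * suc m * (2 * 2 ^ t * b₁ * g₂)
      ≡⟨ *-cancelˡ-≡ _ _ (suc t) (algebra m (2 ^ t) b₁ b₀ g g₁ g₂ (+-suc t s) (centralBinomial-suc s)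
                                     (C-absorb (suc (m + t)) m) (C-suc-upper m t)) ⟩
    4 * ((2 * m + 2 * t + 2) * (2 ^ t * b₁ * g) + (2 * s + 1) * (2 * 2 ^ t * b₀ * g₁))
      ≡⟨ cong₂ (λ x y → 4 * ((2 * m + 2 * t + 2) * x + (2 * s + 1) * y))
               (sym (weight-+ t (suc s))) (sym weight-m[1+t]) ⟩
    4 * ((2 * m + 2 * t + 2) * weight m t + (2 * s + 1) * weight m (suc t)) ∎
    where
    open ≡-Reasoning
    m  = t + suc s
    b₀ = centralBinomial s
    b₁ = centralBinomial (suc s)
    g  = (m + t) C m
    g₁ = suc (m + t) C m
    g₂ = suc (suc (m + t)) C suc m
    weight-1+m[1+t] : weight (suc m) (suc t) ≡ 2 * 2 ^ t * b₁ * g₂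
    weight-1+m[1+t] = trans (weight-+ (suc t) (suc s)) (cong (λ n → 2 * 2 ^ t * b₁ * (suc n C suc m)) (+-suc m t))
    weight-m[1+t] : weight m (suc t) ≡ 2 * 2 ^ t * b₀ * g₁
    weight-m[1+t] = trans (subst (λ n → weight n (suc t) ≡ 2 * 2 ^ t * b₀ * ((n + suc t) C n))
                                 (sym (+-suc t s)) (weight-+ (suc t) s))
                          (cong (λ n → 2 * 2 ^ t * b₀ * (n C m)) (+-suc m t))
    algebra : ∀ M p b₁ b₀ g g₁ g₂ → M ≡ 1 + t + s → suc s * b₁ ≡ 2 * (1 + 2 * s) * b₀ →
              (1 + M) * g₂ ≡ (2 + M + t) * g₁ → (1 + t) * g₁ ≡ (1 + M + t) * g →
              (1 + t) * (2 * (1 + M) * (2 * p * b₁ * g₂))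
                ≡ (1 + t) * (4 * ((2 * M + 2 * t + 2) * (p * b₁ * g) + (2 * s + 1) * (2 * p * b₀ * g₁)))
    algebra M p b₁ b₀ g g₁ g₂ h₁ h₂ h₃ h₄ =
      linear-combination (4 * p * b₁ * g * (1 + M + t) · h₁ ⊕ 4 * p * g₁ * (1 + t) · h₂
                          ⊕ 4 * p * b₁ * (1 + t) · h₃
                          ⊕ 4 * p * b₁ * (1 + M + t) · h₄ ⊕ 4 * p * b₁ * s · sym h₄)
                         (solve (t ∷ s ∷ M ∷ p ∷ b₁ ∷ b₀ ∷ g ∷ g₁ ∷ g₂ ∷ []))

  weight-suc-m : ∀ {m t} → t < m →
                 2 * suc m * weight (suc m) (suc t)
                   ≡ 4 * ((2 * m + 2 * t + 2) * weight m t + (2 * (m ∸ suc t) + 1) * weight m (suc t))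
  weight-suc-m {t = t} t<m with m≤n⇒∃[o]m+o≡n t<m
  ... | s , refl = trans (subst P (+-suc t s) (weight-suc-m-+ t s))
                        (cong (λ n → 4 * ((2 * suc (t + s) + 2 * t + 2) * weight (suc t + s) t
                                         + (2 * n + 1) * weight (suc t + s) (suc t))) (sym (m+n∸m≡n t s)))
    where
    P : ℕ → Set
    P m = 2 * suc m * weight (suc m) (suc t) ≡ 4 * ((2 * m + 2 * t + 2) * weight m t + (2 * s + 1) * weight m (suc t))

  weight-diag : ∀ k → weight k k ≡ 2 ^ k * centralBinomial k
  weight-diag k = begin
    2 ^ k * ((2 * k ∸ 2 * k) C (k ∸ k)) * ((k + k) C k)
      ≡⟨ cong₂ (λ x y → 2 ^ k * (x C y) * ((k + k) C k)) (n∸n≡0 (2 * k)) (n∸n≡0 k) ⟩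
    2 ^ k * 1 * ((k + k) C k)
      ≡⟨ cong₂ _*_ (*-identityʳ (2 ^ k)) (cong (λ n → (k + n) C k) (sym (+-identityʳ k))) ⟩
    2 ^ k * centralBinomial k ∎
    where open ≡-Reasoning

  weight-zero : ∀ m → weight m 0 ≡ centralBinomial m
  weight-zero m = begin
    1 * ((2 * m) C m) * ((m + 0) C m)  ≡⟨ cong (λ n → 1 * ((2 * m) C m) * (n C m)) (+-identityʳ m) ⟩
    1 * ((2 * m) C m) * (m C m)        ≡⟨ 1 * ((2 * m) C m) · nCn≡1 m ⟩
    1 * ((2 * m) C m) * 1              ≡⟨ trans (*-identityʳ _) (*-identityˡ _) ⟩
    centralBinomial m                  ∎
    where open ≡-Reasoning

  weight-suc-diag : ∀ t → 2 * suc t * weight (suc t) (suc t) ≡ 4 * ((4 * t + 2) * weight t t)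
  weight-suc-diag t = begin
    2 * suc t * weight (suc t) (suc t)             ≡⟨ 2 * suc t · weight-diag (suc t) ⟩
    2 * suc t * (2 * 2 ^ t * b₁)                   ≡⟨ algebra (2 ^ t) b₁ b₀ (centralBinomial-suc t) ⟩
    4 * ((4 * t + 2) * (2 ^ t * b₀))               ≡⟨ cong (λ z → 4 * ((4 * t + 2) * z)) (sym (weight-diag t)) ⟩
    4 * ((4 * t + 2) * weight t t)                 ∎
    where
    open ≡-Reasoning
    b₀ = centralBinomial t
    b₁ = centralBinomial (suc t)
    algebra : ∀ p b₁ b₀ → suc t * b₁ ≡ 2 * (1 + 2 * t) * b₀ →
              2 * suc t * (2 * p * b₁) ≡ 4 * ((4 * t + 2) * (p * b₀))
    algebra p b₁ b₀ h = linear-combination (4 * p · h) (solve (t ∷ p ∷ b₁ ∷ b₀ ∷ []))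

  weight-suc-zero : ∀ m → 2 * suc m * weight (suc m) 0 ≡ 4 * ((1 + 2 * m) * weight m 0)
  weight-suc-zero m = begin
    2 * suc m * weight (suc m) 0                   ≡⟨ 2 * suc m · weight-zero (suc m) ⟩
    2 * suc m * centralBinomial (suc m)            ≡⟨ algebra _ _ (centralBinomial-suc m) ⟩
    4 * ((1 + 2 * m) * centralBinomial m)          ≡⟨ cong (λ z → 4 * ((1 + 2 * m) * z)) (sym (weight-zero m)) ⟩
    4 * ((1 + 2 * m) * weight m 0)                 ∎
    where
    open ≡-Reasoning
    algebra : ∀ b₁ b₀ → suc m * b₁ ≡ 2 * (1 + 2 * m) * b₀ → 2 * suc m * b₁ ≡ 4 * ((1 + 2 * m) * b₀)
    algebra b₁ b₀ h = linear-combination (2 · h) (solve (m ∷ b₁ ∷ b₀ ∷ []))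

  dNum-pos : ∀ {m i} → i ≤ m → 0 < dNum m i
  dNum-pos {m} {i} i≤m = <-≤-trans last-term-pos (f[n]≤Σ≤ m (λ k → weight m k * (k C i)))
    where
    last-term-pos : 0 < weight m m * (m C i)
    last-term-pos rewrite weight-diag m =
      *-mono-< (*-mono-< (m^n>0 2 m) (C-pos (m≤m+n m (m + 0)))) (C-pos i≤m)

  dNum-vanish : ∀ m → dNum m (suc m) ≡ 0
  dNum-vanish m = Σ≤-zero m _ (λ {k} k≤m → trans (weight m k · k>n⇒nCk≡0 (s≤s k≤m)) (*-zeroʳ (weight m k)))

  -- Recurrences of dNum
  stepSummand : ℕ → ℕ → ℕ → ℕ
  stepSummand m i k = (2 * (m ∸ k) + 1) * (weight m k * (k C i))
                    + (2 * m + 2 * k + 2) * weight m k * (suc k C i)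

  dNum-suc≡Σ-stepSummand : ∀ m i → 2 * suc m * dNum (suc m) i ≡ 4 * Σ≤ m (stepSummand m i)
  dNum-suc≡Σ-stepSummand m i = begin
    2 * suc m * dNum (suc m) i         ≡⟨ sym (Σ≤-distribˡ-* (suc m) (2 * suc m) _) ⟩
    Σ≤ m F + F (suc m)                 ≡⟨ cong (Σ≤ m F +_) F[1+m] ⟩
    Σ≤ m F + 4 * A m                   ≡⟨ partial-sums m ≤-refl ⟩
    4 * (Σ≤ m E + Σ≤ m A)              ≡⟨ 4 · sym (Σ≤-distrib-+ m E A) ⟩
    4 * Σ≤ m (stepSummand m i)         ∎
    where
    open ≡-Reasoning
    F E A : ℕ → ℕ
    F k = 2 * suc m * (weight (suc m) k * (k C i))
    E k = (2 * (m ∸ k) + 1) * (weight m k * (k C i))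
    A k = (2 * m + 2 * k + 2) * weight m k * (suc k C i)

    F[0] : F 0 ≡ 4 * E 0
    F[0] = algebra _ (weight m 0) (0 C i) (weight-suc-zero m)
      where
      algebra : ∀ x u w → 2 * suc m * x ≡ 4 * ((1 + 2 * m) * u) →
                2 * suc m * (x * w) ≡ 4 * ((2 * m + 1) * (u * w))
      algebra x u w h = linear-combination (w · h) (solve (m ∷ x ∷ u ∷ w ∷ []))

    F[1+t] : ∀ {t} → t < m → F (suc t) ≡ 4 * (A t + E (suc t))
    F[1+t] {t} t<m = algebra _ (2 * m + 2 * t + 2) (2 * (m ∸ suc t) + 1) (weight m t) (weight m (suc t))
                             (suc t C i) (weight-suc-m t<m)
      where
      algebra : ∀ x y z u v w → 2 * suc m * x ≡ 4 * (y * u + z * v) →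
                2 * suc m * (x * w) ≡ 4 * (y * u * w + z * (v * w))
      algebra x y z u v w h = linear-combination (w · h) (solve (m ∷ x ∷ y ∷ z ∷ u ∷ v ∷ w ∷ []))

    F[1+m] : F (suc m) ≡ 4 * A m
    F[1+m] = algebra _ (weight m m) (suc m C i) (weight-suc-diag m)
      where
      algebra : ∀ x u w → 2 * suc m * x ≡ 4 * ((4 * m + 2) * u) →
                2 * suc m * (x * w) ≡ 4 * ((2 * m + 2 * m + 2) * u * w)
      algebra x u w h = linear-combination (w · h) (solve (m ∷ x ∷ u ∷ w ∷ []))

    partial-sums : ∀ t → t ≤ m → Σ≤ t F + 4 * A t ≡ 4 * (Σ≤ t E + Σ≤ t A)
    partial-sums zero    _   = trans (cong (_+ 4 * A 0) F[0]) (sym (*-distribˡ-+ 4 (E 0) (A 0)))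
    partial-sums (suc t) t<m = begin
      Σ≤ t F + F (suc t) + 4 * A (suc t)              ≡⟨ cong (λ f → Σ≤ t F + f + 4 * A (suc t)) (F[1+t] t<m) ⟩
      Σ≤ t F + 4 * (A t + E (suc t)) + 4 * A (suc t)  ≡⟨ regroup (Σ≤ t F) (A t) (E (suc t)) (A (suc t)) ⟩
      Σ≤ t F + 4 * A t + 4 * (E (suc t) + A (suc t))  ≡⟨ cong (_+ 4 * (E (suc t) + A (suc t))) (partial-sums t (<⇒≤ t<m)) ⟩
      4 * (Σ≤ t E + Σ≤ t A) + 4 * (E (suc t) + A (suc t))
        ≡⟨ regroup′ (Σ≤ t E) (Σ≤ t A) (E (suc t)) (A (suc t)) ⟩
      4 * (Σ≤ t E + E (suc t) + (Σ≤ t A + A (suc t))) ∎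
      where
      regroup : ∀ f a e a′ → f + 4 * (a + e) + 4 * a′ ≡ f + 4 * a + 4 * (e + a′)
      regroup f a e a′ = solve (f ∷ a ∷ e ∷ a′ ∷ [])
      regroup′ : ∀ e a e′ a′ → 4 * (e + a) + 4 * (e′ + a′) ≡ 4 * (e + e′ + (a + a′))
      regroup′ e a e′ a′ = solve (e ∷ a ∷ e′ ∷ a′ ∷ [])

  stepSummand-suc : ∀ j {k m} → k ≤ m →
    stepSummand m (suc j) k
      ≡ 2 * (m + j + 1) * (weight m k * (k C j)) + (4 * m + 2 * j + 5) * (weight m k * (k C suc j))
  stepSummand-suc j = by-difference {P = P} summand
    where
    open ≡-Reasoning
    P : ℕ → ℕ → Set
    P k m = stepSummand m (suc j) k
              ≡ 2 * (m + j + 1) * (weight m k * (k C j)) + (4 * m + 2 * j + 5) * (weight m k * (k C suc j))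
    summand : ∀ k s → P k (k + s)
    summand k s = begin
      (2 * (k + s ∸ k) + 1) * (c * b) + (2 * (k + s) + 2 * k + 2) * c * (suc k C suc j)
        ≡⟨ cong₂ (λ x y → (2 * x + 1) * (c * b) + (2 * (k + s) + 2 * k + 2) * c * y)
                 (m+n∸m≡n k s) (C-pascal k j) ⟩
      (2 * s + 1) * (c * b) + (2 * (k + s) + 2 * k + 2) * c * (a + b)
        ≡⟨ algebra c a b (C-ratio k j) ⟩
      2 * (k + s + j + 1) * (c * a) + (4 * (k + s) + 2 * j + 5) * (c * b) ∎
      where
      c = weight (k + s) k
      a = k C j
      b = k C suc j
      algebra : ∀ c a b → suc j * b + j * a ≡ k * a →
                (2 * s + 1) * (c * b) + (2 * (k + s) + 2 * k + 2) * c * (a + b)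
                  ≡ 2 * (k + s + j + 1) * (c * a) + (4 * (k + s) + 2 * j + 5) * (c * b)
      algebra c a b h = linear-combination (2 * c · sym h) (solve (j ∷ k ∷ s ∷ c ∷ a ∷ b ∷ []))

  dNum-suc-suc : ∀ m j → 2 * suc m * dNum (suc m) (suc j)
                           ≡ 8 * (m + j + 1) * dNum m j + 4 * (4 * m + 2 * j + 5) * dNum m (suc j)
  dNum-suc-suc m j = begin
    2 * suc m * dNum (suc m) (suc j)                            ≡⟨ dNum-suc≡Σ-stepSummand m (suc j) ⟩
    4 * Σ≤ m (stepSummand m (suc j))                            ≡⟨ 4 · Σ≤-cong m (stepSummand-suc j) ⟩
    4 * Σ≤ m (λ k → α * (weight m k * (k C j)) + β * (weight m k * (k C suc j)))
      ≡⟨ 4 · trans (Σ≤-distrib-+ m _ _) (Σ≤-distribˡ-* m α _ ⊕ Σ≤-distribˡ-* m β _) ⟩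
    4 * (α * dNum m j + β * dNum m (suc j))                     ≡⟨ algebra (dNum m j) (dNum m (suc j)) ⟩
    8 * (m + j + 1) * dNum m j + 4 * β * dNum m (suc j)         ∎
    where
    open ≡-Reasoning
    α = 2 * (m + j + 1)
    β = 4 * m + 2 * j + 5
    algebra : ∀ x y → 4 * (2 * (m + j + 1) * x + (4 * m + 2 * j + 5) * y)
                        ≡ 8 * (m + j + 1) * x + 4 * (4 * m + 2 * j + 5) * y
    algebra x y = solve (m ∷ j ∷ x ∷ y ∷ [])

  dNum-suc-zero : ∀ m → 2 * suc m * dNum (suc m) 0 ≡ 4 * (4 * m + 3) * dNum m 0
  dNum-suc-zero m = begin
    2 * suc m * dNum (suc m) 0                                  ≡⟨ dNum-suc≡Σ-stepSummand m 0 ⟩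
    4 * Σ≤ m (stepSummand m 0)                                  ≡⟨ 4 · Σ≤-cong m (by-difference {P = P} summand) ⟩
    4 * Σ≤ m (λ k → (4 * m + 3) * (weight m k * (k C 0)))       ≡⟨ 4 · Σ≤-distribˡ-* m (4 * m + 3) _ ⟩
    4 * ((4 * m + 3) * dNum m 0)                                ≡⟨ sym (*-assoc 4 (4 * m + 3) (dNum m 0)) ⟩
    4 * (4 * m + 3) * dNum m 0                                  ∎
    where
    open ≡-Reasoning
    P : ℕ → ℕ → Set
    P k m = stepSummand m 0 k ≡ (4 * m + 3) * (weight m k * (k C 0))
    summand : ∀ k s → P k (k + s)
    summand k s = trans (cong (λ x → (2 * x + 1) * (c * 1) + (2 * (k + s) + 2 * k + 2) * c * 1) (m+n∸m≡n k s))
                        (algebra c)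
      where
      c = weight (k + s) k
      algebra : ∀ c → (2 * s + 1) * (c * 1) + (2 * (k + s) + 2 * k + 2) * c * 1 ≡ (4 * (k + s) + 3) * (c * 1)
      algebra c = solve (k ∷ s ∷ c ∷ [])

  C-absorb-pred : ∀ k j → k * ((k ∸ 1) C j) ≡ suc j * (k C suc j)
  C-absorb-pred zero    j = sym (*-zeroʳ (suc j))
  C-absorb-pred (suc k) j = sym (C-absorb k j)

  telescopeL telescopeR : ℕ → ℕ → ℕ → ℕ
  telescopeL m j k = weight m k * (k * (2 * (m ∸ k) + 1) * ((k ∸ 1) C j))
  telescopeR m j k = weight m k * ((m ∸ k) * (m + k + 1) * (k C j))

  telescopeL-suc : ∀ j {t m} → t < m → telescopeL m j (suc t) ≡ telescopeR m j t
  telescopeL-suc j {t} t<m with m≤n⇒∃[o]m+o≡n t<m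
  ... | s , refl = begin
    weight m (suc t) * (suc t * (2 * (t + s ∸ t) + 1) * x)
      ≡⟨ cong (λ n → weight m (suc t) * (suc t * (2 * n + 1) * x)) (m+n∸m≡n t s) ⟩
    weight m (suc t) * (suc t * (2 * s + 1) * x)          ≡⟨ regroup t s (weight m (suc t)) x ⟩
    suc t * (1 + 2 * s) * weight m (suc t) * x            ≡⟨ cong (_* x) (weight-suc-k t s) ⟩
    suc s * (1 + m + t) * weight m t * x                  ≡⟨ regroup′ (suc t + s) t s (weight m t) x ⟩
    weight m t * (suc s * (m + t + 1) * x)
      ≡⟨ cong (λ n → weight m t * (n * (m + t + 1) * x)) (sym m∸t≡1+s) ⟩
    weight m t * ((m ∸ t) * (m + t + 1) * x)              ∎
    where
    open ≡-Reasoning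
    m = suc t + s
    x = t C j
    m∸t≡1+s : m ∸ t ≡ suc s
    m∸t≡1+s = trans (cong (_∸ t) (sym (+-suc t s))) (m+n∸m≡n t (suc s))
    regroup : ∀ t s c x → c * ((1 + t) * (2 * s + 1) * x) ≡ (1 + t) * (1 + 2 * s) * c * x
    regroup t s c x = solve (t ∷ s ∷ c ∷ x ∷ [])
    regroup′ : ∀ m t s c x → (1 + s) * (1 + m + t) * c * x ≡ c * ((1 + s) * (m + t + 1) * x)
    regroup′ m t s c x = solve (m ∷ t ∷ s ∷ c ∷ x ∷ [])

  Σ≤-telescope : ∀ n j → Σ≤ (suc n) (telescopeL (suc n) j) ≡ Σ≤ (suc n) (telescopeR (suc n) j)
  Σ≤-telescope n j = begin
    Σ≤ (suc n) (telescopeL m j)                           ≡⟨ Σ≤-shift n (telescopeL m j) ⟩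
    telescopeL m j 0 + Σ≤ n (λ t → telescopeL m j (suc t)) ≡⟨ *-zeroʳ (weight m 0) ⊕ Σ≤-cong n (λ t≤n → telescopeL-suc j (s≤s t≤n)) ⟩
    0 + Σ≤ n (telescopeR m j)                             ≡⟨ +-comm 0 _ ⟩
    Σ≤ n (telescopeR m j) + 0                             ≡⟨ cong (Σ≤ n (telescopeR m j) +_) (sym telescopeR-last) ⟩
    Σ≤ (suc n) (telescopeR m j)                           ∎
    where
    open ≡-Reasoning
    m = suc n
    telescopeR-last : telescopeR m j m ≡ 0
    telescopeR-last = trans (cong (λ z → weight m m * (z * (m + m + 1) * (m C j))) (n∸n≡0 m)) (*-zeroʳ (weight m m))

  -- From here on i = j + 1 and m = w + j + 1 (so w = m − i): the shift avoids truncated subtraction.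
  -- Termwise the identity holds up to telescopeR − telescopeL, whose sum vanishes.
  dNum-recurrence-i : ∀ j w → let m = suc (w + j) in
    suc w * (m + j + 1) * dNum m j + suc j * (2 + j) * dNum m (2 + j) ≡ suc j * (2 * m + 1) * dNum m (suc j)
  dNum-recurrence-i j w = +-cancelʳ-≡ (Σ≤ m (telescopeL m j)) _ _ (begin
    α * dNum m j + β * dNum m (2 + j) + Σ≤ m (telescopeL m j)
      ≡⟨ cong (_+ Σ≤ m (telescopeL m j)) (sym (Σ≤-distribˡ-* m α _ ⊕ Σ≤-distribˡ-* m β _)) ⟩
    Σ≤ m (λ k → α * (weight m k * (k C j))) + Σ≤ m (λ k → β * (weight m k * (k C (2 + j))))
      + Σ≤ m (telescopeL m j)
      ≡⟨ cong (_+ Σ≤ m (telescopeL m j)) (sym (Σ≤-distrib-+ m _ _)) ⟩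
    Σ≤ m (λ k → α * (weight m k * (k C j)) + β * (weight m k * (k C (2 + j)))) + Σ≤ m (telescopeL m j)
      ≡⟨ sym (Σ≤-distrib-+ m _ (telescopeL m j)) ⟩
    Σ≤ m (λ k → α * (weight m k * (k C j)) + β * (weight m k * (k C (2 + j))) + telescopeL m j k)
      ≡⟨ Σ≤-cong m (λ k≤m → by-difference {P = P} pointwise k≤m refl) ⟩
    Σ≤ m (λ k → γ * (weight m k * (k C suc j)) + telescopeR m j k)
      ≡⟨ Σ≤-distrib-+ m _ (telescopeR m j) ⟩
    Σ≤ m (λ k → γ * (weight m k * (k C suc j))) + Σ≤ m (telescopeR m j)
      ≡⟨ Σ≤-distribˡ-* m γ _ ⊕ sym (Σ≤-telescope (w + j) j) ⟩
    γ * dNum m (suc j) + Σ≤ m (telescopeL m j) ∎)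
    where
    open ≡-Reasoning
    m = suc (w + j)
    α = suc w * (m + j + 1)
    β = suc j * (2 + j)
    γ = suc j * (2 * m + 1)
    P : ℕ → ℕ → Set
    P k n = n ≡ suc (w + j) →
            suc w * (n + j + 1) * (weight n k * (k C j)) + suc j * (2 + j) * (weight n k * (k C (2 + j)))
              + telescopeL n j k
            ≡ suc j * (2 * n + 1) * (weight n k * (k C suc j)) + telescopeR n j k
    pointwise : ∀ k r → P k (k + r)
    pointwise k r k+r≡m = begin
      suc w * (k + r + j + 1) * (c * a) + suc j * (2 + j) * (c * c₂) + c * (k * (2 * (k + r ∸ k) + 1) * e)
        ≡⟨ cong (λ n → suc w * (k + r + j + 1) * (c * a) + suc j * (2 + j) * (c * c₂) + c * (k * (2 * n + 1) * e))
                (m+n∸m≡n k r) ⟩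
      suc w * (k + r + j + 1) * (c * a) + suc j * (2 + j) * (c * c₂) + c * (k * (2 * r + 1) * e)
        ≡⟨ algebra k r c a b c₂ e (C-absorb-pred k j) (C-ratio k j) (C-ratio k (suc j)) k+r≡m ⟩
      suc j * (2 * (k + r) + 1) * (c * b) + c * (r * (k + r + k + 1) * a)
        ≡⟨ cong (λ n → suc j * (2 * (k + r) + 1) * (c * b) + c * (n * (k + r + k + 1) * a))
                (sym (m+n∸m≡n k r)) ⟩
      suc j * (2 * (k + r) + 1) * (c * b) + c * ((k + r ∸ k) * (k + r + k + 1) * a) ∎
      where
      c  = weight (k + r) k
      a  = k C j
      b  = k C suc j
      c₂ = k C (2 + j)
      e  = (k ∸ 1) C j
      algebra : ∀ k r c a b c₂ e → k * e ≡ (1 + j) * b → (1 + j) * b + j * a ≡ k * a →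
                (2 + j) * c₂ + (1 + j) * b ≡ k * b → k + r ≡ 1 + w + j →
                (1 + w) * (k + r + j + 1) * (c * a) + (1 + j) * (2 + j) * (c * c₂) + c * (k * (2 * r + 1) * e)
                  ≡ (1 + j) * (2 * (k + r) + 1) * (c * b) + c * (r * (k + r + k + 1) * a)
      algebra k r c a b c₂ e h₁ h₂ h₃ h₄ =
        linear-combination ((1 + 2 * r) * c · h₁ ⊕ (1 + j + k) * c · sym h₂ ⊕ (1 + j) * c · h₃
                            ⊕ a * c * (1 + j + k + r) · sym h₄)
                           (solve (j ∷ w ∷ k ∷ r ∷ c ∷ a ∷ b ∷ c₂ ∷ e ∷ []))

  dNum-recurrence-mixed : ∀ j w → let m = suc (w + j) in
    2 * suc m * suc w * dNum (suc m) (suc j) + 8 * suc j * (2 + j) * dNum m (2 + j)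
      ≡ 4 * (4 * w + 2 * j + 5) * (m + j + 2) * dNum m (suc j)
  dNum-recurrence-mixed j w = algebra (dNum m j) (dNum m (suc j)) (dNum (suc m) (suc j)) (dNum m (2 + j))
                           (dNum-suc-suc m j) (dNum-recurrence-i j w)
    where
    m = suc (w + j)
    algebra : ∀ a₀ b₀ b₁ c₀ →
      2 * (2 + w + j) * b₁ ≡ 8 * (1 + w + j + j + 1) * a₀ + 4 * (4 * (1 + w + j) + 2 * j + 5) * b₀ →
      (1 + w) * (1 + w + j + j + 1) * a₀ + (1 + j) * (2 + j) * c₀ ≡ (1 + j) * (2 * (1 + w + j) + 1) * b₀ →
      2 * (2 + w + j) * (1 + w) * b₁ + 8 * (1 + j) * (2 + j) * c₀ ≡ 4 * (4 * w + 2 * j + 5) * (1 + w + j + j + 2) * b₀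
    algebra a₀ b₀ b₁ c₀ h₁ h₂ = linear-combination ((1 + w) · h₁ ⊕ 8 · h₂) (solve (j ∷ w ∷ a₀ ∷ b₀ ∷ b₁ ∷ c₀ ∷ []))

  dNum-recurrence-m : ∀ j w → let m = suc (w + j) ; i = suc j in
    suc m * (2 + m) * (2 + w) * dNum (2 + m) i + 4 * (4 * m + 3) * (4 * m + 5) * (m + j + 2) * dNum m i
      ≡ 2 * suc m * (47 + 32 * j + 40 * w + 4 * j * j + 16 * j * w + 8 * w * w) * dNum (suc m) i
  dNum-recurrence-m j w =
    *-cancelˡ-≡ _ _ 4 (algebra (dNum m i) (dNum m (2 + j)) (dNum (suc m) i) (dNum (suc m) (2 + j)) (dNum (2 + m) i)
                               (dNum-recurrence-mixed j w) (dNum-recurrence-mixed j (suc w)) (dNum-suc-suc m (suc j)))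
    where
    m = suc (w + j)
    i = suc j
    algebra : ∀ b₀ c₀ b₁ c₁ b₂ →
      2 * (2 + w + j) * (1 + w) * b₁ + 8 * (1 + j) * (2 + j) * c₀ ≡ 4 * (4 * w + 2 * j + 5) * (1 + w + j + j + 2) * b₀ →
      2 * (3 + w + j) * (2 + w) * b₂ + 8 * (1 + j) * (2 + j) * c₁
        ≡ 4 * (4 * (1 + w) + 2 * j + 5) * (2 + w + j + j + 2) * b₁ →
      2 * (2 + w + j) * c₁ ≡ 8 * (1 + w + j + (1 + j) + 1) * b₀ + 4 * (4 * (1 + w + j) + 2 * (1 + j) + 5) * c₀ →
      4 * ((2 + w + j) * (3 + w + j) * (2 + w) * b₂
           + 4 * (4 * (1 + w + j) + 3) * (4 * (1 + w + j) + 5) * (1 + w + j + j + 2) * b₀)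
        ≡ 4 * (2 * (2 + w + j) * (47 + 32 * j + 40 * w + 4 * j * j + 16 * j * w + 8 * w * w) * b₁)
    algebra b₀ c₀ b₁ c₁ b₂ h₁ h₂ h₃ =
      linear-combination ((44 + 24 * j + 16 * w) · sym h₁ ⊕ (4 + 2 * j + 2 * w) · h₂ ⊕ (16 + 24 * j + 8 * j * j) · sym h₃)
                         (solve (j ∷ w ∷ b₀ ∷ c₀ ∷ b₁ ∷ c₁ ∷ b₂ ∷ []))

  -- The excess

  -- T(m,i) = (polyA + i √polyD) / polyB; polyP and polyQ are the coefficients of the recurrence
  -- for the excess.
  polyA polyB polyD polyP : ℕ → ℕ → ℕ
  polyA j w = 12 + 11 * j + 15 * w + 2 * j * j + 8 * j * w + 4 * w * w
  polyB j w = 2 * (1 + w) * (2 + w + j)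
  polyD j w = 4 * (1 + w + j) + 4 * (1 + j) * (1 + j) + 1
  polyP j w = 16 + 13 * j + 17 * w + 2 * j * j + 8 * j * w + 4 * w * w

  polyQ : ℕ → ℕ
  polyQ j = (1 + j) * (1 + j) * (3 + 8 * j + 4 * j * j)

  dNum-excess-recurrence : ∀ j w → let m = suc (w + j) ; i = suc j in
    polyB j w * polyB j (suc w) * dNum (2 + m) i + 16 * polyP j w * polyA j w * dNum m i
      ≡ 4 * polyB j w * polyA j (suc w) * dNum (suc m) i + 4 * polyP j w * polyB j w * dNum (suc m) i
        + 16 * polyQ j * dNum m i
  dNum-excess-recurrence j w = algebra (dNum m i) (dNum (suc m) i) (dNum (2 + m) i) (dNum-recurrence-m j w)
    where
    m = suc (w + j)
    i = suc j
    algebra : ∀ b₀ b₁ b₂ →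
      (2 + w + j) * (3 + w + j) * (2 + w) * b₂
        + 4 * (4 * (1 + w + j) + 3) * (4 * (1 + w + j) + 5) * (1 + w + j + j + 2) * b₀
        ≡ 2 * (2 + w + j) * (47 + 32 * j + 40 * w + 4 * j * j + 16 * j * w + 8 * w * w) * b₁ →
      2 * (1 + w) * (2 + w + j) * (2 * (2 + w) * (3 + w + j)) * b₂
        + 16 * (16 + 13 * j + 17 * w + 2 * j * j + 8 * j * w + 4 * w * w)
             * (12 + 11 * j + 15 * w + 2 * j * j + 8 * j * w + 4 * w * w) * b₀
        ≡ 4 * (2 * (1 + w) * (2 + w + j))
            * (12 + 11 * j + 15 * (1 + w) + 2 * j * j + 8 * j * (1 + w) + 4 * (1 + w) * (1 + w)) * b₁
          + 4 * (16 + 13 * j + 17 * w + 2 * j * j + 8 * j * w + 4 * w * w) * (2 * (1 + w) * (2 + w + j)) * b₁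
          + 16 * ((1 + j) * (1 + j) * (3 + 8 * j + 4 * j * j)) * b₀
    algebra b₀ b₁ b₂ h = linear-combination (4 * (1 + w) · h) (solve (j ∷ w ∷ b₀ ∷ b₁ ∷ b₂ ∷ []))

  am-gm : ∀ x y → Σ[ g ∈ ℕ ] 2 * x * y + g ≡ x * x + y * y
  am-gm x y with ≤-total x y
  ... | inj₁ x≤y with m≤n⇒∃[o]m+o≡n x≤y
  ...   | d , refl = d * d , solve (x ∷ d ∷ [])
  am-gm x y | inj₂ y≤x with m≤n⇒∃[o]m+o≡n y≤x
  ...   | d , refl = d * d , solve (y ∷ d ∷ [])

  -- The gap equals K (R − F u²), and n D (R − F u²) is a sum of nonnegative terms once
  -- u² ≤ 16 i² D n² and 2 u q ≤ u² + q² are used (gap-certificate).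
  excess-gap : ∀ j w u n s → 0 < n →
    u * u + s ≡ 16 * (1 + j) * (1 + j) * polyD j w * (n * n) →
    (polyP j w * u + 4 * polyQ j * n) * (polyP j w * u + 4 * polyQ j * n)
      < (1 + j) * (1 + j) * polyD j (suc w) * ((u + 4 * polyA j w * n) * (u + 4 * polyA j w * n))
  excess-gap j w u n s n>0 hs = +-cancelʳ-< (K * (F * (u * u))) Y X (begin-strict
    Y + K * (F * (u * u))  <⟨ +-monoʳ-< Y (*-monoʳ-< K quadratic-bound) ⟩
    Y + K * R              ≡⟨ sym (gap-identity j w u n) ⟩
    X + K * (F * (u * u))  ∎)
    where
    open ≤-Reasoning
    X Y : ℕ
    X = (1 + j) * (1 + j) * polyD j (suc w) * ((u + 4 * polyA j w * n) * (u + 4 * polyA j w * n))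
    Y = (polyP j w * u + 4 * polyQ j * n) * (polyP j w * u + 4 * polyQ j * n)
    K F L V R g : ℕ
    K = (9 + 4 * j + 4 * w) * (3 + 2 * j + w) * (1 + w)
    F = 9 + 4 * j + 4 * w
    L = (7 + 4 * j + 4 * w) * (7 + 4 * j + 4 * w) + 4 * (1 + j) * (1 + j) * (5 + 4 * j + 4 * w)
    V = 16 * (1 + w + j) * (1 + j) * (1 + j) + 12 * j * j + 24 * j + 11
    R = 32 * (1 + j) * (1 + j) * u * n + 16 * (1 + j) * (1 + j) * L * n * n
    g = proj₁ (am-gm u (2 * (3 + 8 * j + 4 * j * j) * n))

    gap-identity : ∀ j w u n →
      (1 + j) * (1 + j) * (4 * (2 + w + j) + 4 * (1 + j) * (1 + j) + 1)
        * ((u + 4 * (12 + 11 * j + 15 * w + 2 * j * j + 8 * j * w + 4 * w * w) * n)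
           * (u + 4 * (12 + 11 * j + 15 * w + 2 * j * j + 8 * j * w + 4 * w * w) * n))
      + (9 + 4 * j + 4 * w) * (3 + 2 * j + w) * (1 + w) * ((9 + 4 * j + 4 * w) * (u * u))
      ≡ ((16 + 13 * j + 17 * w + 2 * j * j + 8 * j * w + 4 * w * w) * u
           + 4 * ((1 + j) * (1 + j) * (3 + 8 * j + 4 * j * j)) * n)
        * ((16 + 13 * j + 17 * w + 2 * j * j + 8 * j * w + 4 * w * w) * u
           + 4 * ((1 + j) * (1 + j) * (3 + 8 * j + 4 * j * j)) * n)
      + (9 + 4 * j + 4 * w) * (3 + 2 * j + w) * (1 + w)
        * (32 * (1 + j) * (1 + j) * u * n
           + 16 * (1 + j) * (1 + j) * ((7 + 4 * j + 4 * w) * (7 + 4 * j + 4 * w)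
                                       + 4 * (1 + j) * (1 + j) * (5 + 4 * j + 4 * w)) * n * n)
    gap-identity j w u n = solve (j ∷ w ∷ u ∷ n ∷ [])

    gap-certificate : ∀ j w u n s g →
      u * u + s ≡ 16 * (1 + j) * (1 + j) * (4 * (1 + w + j) + 4 * (1 + j) * (1 + j) + 1) * (n * n) →
      2 * u * (2 * (3 + 8 * j + 4 * j * j) * n) + g
        ≡ u * u + 2 * (3 + 8 * j + 4 * j * j) * n * (2 * (3 + 8 * j + 4 * j * j) * n) →
      n * (4 * (1 + w + j) + 4 * (1 + j) * (1 + j) + 1)
        * (32 * (1 + j) * (1 + j) * u * n
           + 16 * (1 + j) * (1 + j) * ((7 + 4 * j + 4 * w) * (7 + 4 * j + 4 * w)
                                       + 4 * (1 + j) * (1 + j) * (5 + 4 * j + 4 * w)) * n * n)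
      ≡ n * (4 * (1 + w + j) + 4 * (1 + j) * (1 + j) + 1) * (9 + 4 * j + 4 * w) * (u * u)
        + (s * (n * ((7 + 4 * j + 4 * w) * (7 + 4 * j + 4 * w) + 4 * (1 + j) * (1 + j) * (5 + 4 * j + 4 * w)) + u)
           + u * g + 4 * (16 * (1 + w + j) * (1 + j) * (1 + j) + 12 * j * j + 24 * j + 11) * n * n * u)
    gap-certificate j w u n s g h₁ h₂ =
      linear-combination
        ((n * ((7 + 4 * j + 4 * w) * (7 + 4 * j + 4 * w) + 4 * (1 + j) * (1 + j) * (5 + 4 * j + 4 * w)) + u) · sym h₁
         ⊕ u · sym h₂)
        (solve (j ∷ w ∷ u ∷ n ∷ s ∷ g ∷ []))

    certificate-pos : ∀ u s g → u * u + s ≡ 16 * (1 + j) * (1 + j) * polyD j w * (n * n) →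
            0 < s * (n * L + u) + u * g + 4 * V * n * n * u
    certificate-pos zero    s g hs = <-≤-trans (*-mono-< s>0 (subst (0 <_) (sym (+-identityʳ _)) (*-mono-< n>0 z<s)))
                                     (≤-trans (m≤m+n _ _) (m≤m+n _ _))
      where
      s>0 : 0 < s
      s>0 = subst (0 <_) (sym hs) (*-mono-< {0} {16 * (1 + j) * (1 + j) * polyD j w} z<s (*-mono-< n>0 n>0))
    certificate-pos (suc u) s g _  = <-≤-trans (*-mono-< {0} {4 * V * n * n} (*-mono-< (*-mono-< {0} {4 * V} z<s n>0) n>0) z<s)
                                     (m≤n+m _ _)

    quadratic-bound : F * (u * u) < R
    quadratic-bound = *-cancelˡ-< (n * polyD j w) (F * (u * u)) R (begin-strict
      n * polyD j w * (F * (u * u))                                ≡⟨ *-assoc (n * polyD j w) F (u * u) ⟨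
      n * polyD j w * F * (u * u)                                  <⟨ m<m+n _ (certificate-pos u s g hs) ⟩
      n * polyD j w * F * (u * u) + (s * (n * L + u) + u * g + 4 * V * n * n * u)
        ≡⟨ gap-certificate j w u n s g hs (proj₂ (am-gm u (2 * (3 + 8 * j + 4 * j * j) * n))) ⟨
      n * polyD j w * R                                            ∎)

  excess-square-next : ∀ j w {u s n₀ n₁ u′} → 0 < n₀ →
    u * u + s ≡ 16 * (1 + j) * (1 + j) * polyD j w * (n₀ * n₀) →
    polyB j w * n₁ ≡ u + 4 * polyA j w * n₀ →
    polyB j w * u′ ≡ 4 * polyP j w * u + 16 * polyQ j * n₀ →
    u′ * u′ < 16 * (1 + j) * (1 + j) * polyD j (suc w) * (n₁ * n₁)
  excess-square-next j w {u} {s} {n₀} {n₁} {u′} n₀>0 hs excess recurrence = *-cancelˡ-< (B * B) _ _ (begin-strict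
    B * B * (u′ * u′)                                      ≡⟨ square-mul B u′ ⟩
    B * u′ * (B * u′)                                      ≡⟨ cong (λ x → x * x) recurrence ⟩
    (4 * P * u + 16 * Q * n₀) * (4 * P * u + 16 * Q * n₀)  ≡⟨ sixteen P u Q n₀ ⟩
    16 * ((P * u + 4 * Q * n₀) * (P * u + 4 * Q * n₀))     <⟨ *-monoʳ-< 16 (excess-gap j w u n₀ s n₀>0 hs) ⟩
    16 * ((1 + j) * (1 + j) * D₁ * ((u + 4 * A * n₀) * (u + 4 * A * n₀)))
      ≡⟨ cong (λ x → 16 * ((1 + j) * (1 + j) * D₁ * (x * x))) excess ⟨
    16 * ((1 + j) * (1 + j) * D₁ * (B * n₁ * (B * n₁)))   ≡⟨ sixteen′ B (1 + j) D₁ n₁ ⟩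
    B * B * (16 * (1 + j) * (1 + j) * D₁ * (n₁ * n₁))      ∎)
    where
    open ≤-Reasoning
    B = polyB j w
    P = polyP j w
    Q = polyQ j
    A = polyA j w
    D₁ = polyD j (suc w)
    square-mul : ∀ a b → a * a * (b * b) ≡ a * b * (a * b)
    square-mul a b = solve (a ∷ b ∷ [])
    sixteen : ∀ p u q n → (4 * p * u + 16 * q * n) * (4 * p * u + 16 * q * n)
                            ≡ 16 * ((p * u + 4 * q * n) * (p * u + 4 * q * n))
    sixteen p u q n = solve (p ∷ u ∷ q ∷ n ∷ [])
    sixteen′ : ∀ b i d n → 16 * (i * i * d * (b * n * (b * n))) ≡ b * b * (16 * i * i * d * (n * n))
    sixteen′ b i d n = solve (b ∷ i ∷ d ∷ n ∷ [])

  excess-step : ∀ j w {u} → let m = suc (w + j) ; i = suc j in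
    polyB j w * dNum (suc m) i ≡ u + 4 * polyA j w * dNum m i →
    Σ[ u′ ∈ ℕ ] (polyB j (suc w) * dNum (2 + m) i ≡ u′ + 4 * polyA j (suc w) * dNum (suc m) i)
              × (polyB j w * u′ ≡ 4 * polyP j w * u + 16 * polyQ j * dNum m i)
  excess-step j w {u} excess = u′ , sym (m∸n+n≡m next-excess-nonneg) , excess-recurrence
    where
    m = suc (w + j)
    i = suc j
    Bw = polyB j w
    next-term = 4 * polyA j (suc w) * dNum (suc m) i
    X = 4 * polyP j w * u + 16 * polyQ j * dNum m i
    scaled : Bw * (polyB j (suc w) * dNum (2 + m) i) ≡ Bw * next-term + X
    scaled = algebra Bw (polyB j (suc w)) (polyA j w) (polyA j (suc w)) (polyP j w) (polyQ j) u
                     (dNum m i) (dNum (suc m) i) (dNum (2 + m) i) (dNum-excess-recurrence j w) excess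
      where
      algebra : ∀ B B₁ A A₁ P Q u n₀ n₁ n₂ →
        B * B₁ * n₂ + 16 * P * A * n₀ ≡ 4 * B * A₁ * n₁ + 4 * P * B * n₁ + 16 * Q * n₀ →
        B * n₁ ≡ u + 4 * A * n₀ →
        B * (B₁ * n₂) ≡ B * (4 * A₁ * n₁) + (4 * P * u + 16 * Q * n₀)
      algebra B B₁ A A₁ P Q u n₀ n₁ n₂ h₁ h₂ =
        linear-combination (1 · h₁ ⊕ 4 * P · h₂) (solve (B ∷ B₁ ∷ A ∷ A₁ ∷ P ∷ Q ∷ u ∷ n₀ ∷ n₁ ∷ n₂ ∷ []))
    next-excess-nonneg : next-term ≤ polyB j (suc w) * dNum (2 + m) i
    next-excess-nonneg = *-cancelˡ-≤ Bw (subst (Bw * next-term ≤_) (sym scaled) (m≤m+n _ _))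
    u′ = polyB j (suc w) * dNum (2 + m) i ∸ next-term
    excess-recurrence : Bw * u′ ≡ X
    excess-recurrence = begin
      Bw * u′                                                ≡⟨ *-distribˡ-∸ Bw _ next-term ⟩
      Bw * (polyB j (suc w) * dNum (2 + m) i) ∸ Bw * next-term ≡⟨ cong (_∸ Bw * next-term) scaled ⟩
      Bw * next-term + X ∸ Bw * next-term                    ≡⟨ m+n∸m≡n (Bw * next-term) X ⟩
      X                                                      ∎
      where open ≡-Reasoning

  -- The excess u = B N(m+1,i) − 4 A N(m,i) equals 4 B N(m,i) (ratio − A/B), so comparing u² with
  -- 16 i² D N(m,i)² compares the ratio with T(m,i).
  record ExcessBound (_~_ : ℕ → ℕ → Set) (j w : ℕ) : Set where
    constructor excess⟨_,_,_⟩
    field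
      u      : ℕ
      excess : polyB j w * dNum (2 + w + j) (suc j) ≡ u + 4 * polyA j w * dNum (suc (w + j)) (suc j)
      bound  : (u * u) ~ (16 * (1 + j) * (1 + j) * polyD j w
                            * (dNum (suc (w + j)) (suc j) * dNum (suc (w + j)) (suc j)))

  ExcessBound-map : ∀ {_~_ _≈_ : ℕ → ℕ → Set} → (∀ {a b} → a ~ b → a ≈ b) →
                    ∀ {j w} → ExcessBound _~_ j w → ExcessBound _≈_ j w
  ExcessBound-map f excess⟨ u , excess , bound ⟩ = excess⟨ u , excess , f bound ⟩

  -- At m = i the term N(i, i+1) vanishes, and D = (2i+1)² makes the bound an equality.
  excess-diag : ∀ j → ExcessBound _≡_ j 0
  excess-diag j = excess⟨ 4 * (1 + j) * (3 + 2 * j) * dNum i i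
                        , algebra (dNum i j) (dNum i i) (dNum (suc i) i) (dNum i (2 + j))
                                  (dNum-suc-suc i j) (dNum-recurrence-i j 0) (dNum-vanish i)
                        , square (dNum i i) ⟩
    where
    i = suc j
    algebra : ∀ a₀ b₀ b₁ c₀ →
      2 * (2 + j) * b₁ ≡ 8 * (1 + j + j + 1) * a₀ + 4 * (4 * (1 + j) + 2 * j + 5) * b₀ →
      1 * (1 + j + j + 1) * a₀ + (1 + j) * (2 + j) * c₀ ≡ (1 + j) * (2 * (1 + j) + 1) * b₀ → c₀ ≡ 0 →
      2 * (1 + 0) * (2 + 0 + j) * b₁
        ≡ 4 * (1 + j) * (3 + 2 * j) * b₀ + 4 * (12 + 11 * j + 15 * 0 + 2 * j * j + 8 * j * 0 + 4 * 0 * 0) * b₀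
    algebra a₀ b₀ b₁ c₀ h₁ h₂ h₃ =
      linear-combination (1 · h₁ ⊕ 8 · h₂ ⊕ (16 + 24 * j + 8 * j * j) · sym h₃)
                         (solve (j ∷ a₀ ∷ b₀ ∷ b₁ ∷ c₀ ∷ []))
    square : ∀ n → 4 * (1 + j) * (3 + 2 * j) * n * (4 * (1 + j) * (3 + 2 * j) * n)
                     ≡ 16 * (1 + j) * (1 + j) * (4 * (1 + 0 + j) + 4 * (1 + j) * (1 + j) + 1) * (n * n)
    square n = solve (j ∷ n ∷ [])

  excess-bound-step : ∀ j w → ExcessBound _≤_ j w → ExcessBound _<_ j (suc w)
  excess-bound-step j w excess⟨ u , excess , u²≤ ⟩ =
    let s , hs = m≤n⇒∃[o]m+o≡n u²≤
        u′ , excess′ , recurrence = excess-step j w {u} excess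
        n₀>0 = dNum-pos (s≤s (m≤n+m j w))
    in excess⟨ u′ , excess′ , excess-square-next j w {u} {s} {dNum (suc (w + j)) (suc j)}
                                {dNum (2 + w + j) (suc j)} {u′} n₀>0 hs excess recurrence ⟩

  excess-bound : ∀ j w → ExcessBound _≤_ j w
  excess-bound j zero    = ExcessBound-map ≤-reflexive (excess-diag j)
  excess-bound j (suc w) = ExcessBound-map <⇒≤ (excess-bound-step j w (excess-bound j w))

  denominator : ℕ → ℕ → ℕ
  denominator m i = 2 * (m ∸ i + 1) * (m + 1)

  polyB≡denominator : ∀ j w → polyB j w ≡ denominator (suc (w + j)) (suc j)
  polyB≡denominator j w = begin
    2 * (1 + w) * (2 + w + j)              ≡⟨ solve (j ∷ w ∷ []) ⟩
    2 * (w + 1) * (suc (w + j) + 1)        ≡⟨ cong (λ n → 2 * (n + 1) * (suc (w + j) + 1)) (sym (m+n∸n≡m w j)) ⟩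
    2 * (w + j ∸ j + 1) * (suc (w + j) + 1) ∎
    where open ≡-Reasoning

  polyA+2i² : ∀ j w → let m = suc (w + j) ; i = suc j in polyA j w + 2 * i * i ≡ 4 * m * m + 7 * m + 3
  polyA+2i² j w = algebra
    where
    algebra : 12 + 11 * j + 15 * w + 2 * j * j + 8 * j * w + 4 * w * w + 2 * (1 + j) * (1 + j)
                ≡ 4 * (1 + w + j) * (1 + w + j) + 7 * (1 + w + j) + 3
    algebra = solve (j ∷ w ∷ [])

  dNum-excess-zero : ∀ m → denominator m 0 * dNum (suc m) 0 ≡ 0 + 4 * (4 * m * m + 7 * m + 3) * dNum m 0
  dNum-excess-zero m = algebra (dNum m 0) (dNum (suc m) 0) (dNum-suc-zero m)
    where
    algebra : ∀ n₀ n₁ → 2 * suc m * n₁ ≡ 4 * (4 * m + 3) * n₀ →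
              2 * (m + 1) * (m + 1) * n₁ ≡ 0 + 4 * (4 * m * m + 7 * m + 3) * n₀
    algebra n₀ n₁ h = linear-combination ((m + 1) · h) (solve (m ∷ n₀ ∷ n₁ ∷ []))

module Ratios where

  open import Data.Nat as ℕ using (ℕ; zero; suc; z≤n; s≤s)
  import Data.Nat.Properties as ℕ
  open import Data.Nat.Tactic.RingSolver using () renaming (solve to ℕ-solve)
  open import Data.Integer as ℤ using (ℤ; +_; +[1+_]; -[1+_])
  import Data.Integer.Properties as ℤ
  open import Data.Rational
  open import Data.Rational.Properties
  open import Data.Rational.Unnormalised as ℚᵘ using (mkℚᵘ; *≡*; *<*; *≤*)
  import Data.Rational.Unnormalised.Properties as ℚᵘ
  open import Data.Rational.Solver using (module +-*-Solver)
  open import Data.List using ([]; _∷_)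
  open import Data.Product using (_,_)
  open import Data.Sum using (inj₂)
  open import Relation.Binary.PropositionalEquality

  open Numerators
    using (dNum-pos; polyA; denominator; polyB≡denominator; polyA+2i²; dNum-excess-zero;
           ExcessBound; excess-diag; excess-bound; excess-bound-step)

  -- The indices m, i are passed explicitly throughout: inferring them by unification from types
  -- such as ratio m i makes Agda unfold dNum, a sum of products of binomials, and exhaust memory.
  private
    toℚᵘ-ℕtoℚ : ∀ n → toℚᵘ (ℕtoℚ n) ℚᵘ.≃ mkℚᵘ (+ n) 0
    toℚᵘ-ℕtoℚ n = toℚᵘ-fromℚᵘ (mkℚᵘ (+ n) 0)

  ℕtoℚ-homo-+ : ∀ a b → ℕtoℚ (a ℕ.+ b) ≡ ℕtoℚ a + ℕtoℚ b
  ℕtoℚ-homo-+ a b = toℚᵘ-injective (ℚᵘ.≃-trans (toℚᵘ-ℕtoℚ (a ℕ.+ b)) (ℚᵘ.≃-trans pos-+ (ℚᵘ.≃-sym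
    (ℚᵘ.≃-trans (toℚᵘ-homo-+ (ℕtoℚ a) (ℕtoℚ b)) (ℚᵘ.+-cong (toℚᵘ-ℕtoℚ a) (toℚᵘ-ℕtoℚ b))))))
    where
    pos-+ : mkℚᵘ (+ (a ℕ.+ b)) 0 ℚᵘ.≃ mkℚᵘ (+ a) 0 ℚᵘ.+ mkℚᵘ (+ b) 0
    pos-+ = *≡* (cong (ℤ._* + 1) (trans (ℤ.pos-+ a b) (sym (cong₂ ℤ._+_ (ℤ.*-identityʳ (+ a)) (ℤ.*-identityʳ (+ b))))))

  ℕtoℚ-homo-* : ∀ a b → ℕtoℚ (a ℕ.* b) ≡ ℕtoℚ a * ℕtoℚ b
  ℕtoℚ-homo-* a b = toℚᵘ-injective (ℚᵘ.≃-trans (toℚᵘ-ℕtoℚ (a ℕ.* b)) (ℚᵘ.≃-trans pos-* (ℚᵘ.≃-sym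
    (ℚᵘ.≃-trans (toℚᵘ-homo-* (ℕtoℚ a) (ℕtoℚ b)) (ℚᵘ.*-cong (toℚᵘ-ℕtoℚ a) (toℚᵘ-ℕtoℚ b))))))
    where
    pos-* : mkℚᵘ (+ (a ℕ.* b)) 0 ℚᵘ.≃ mkℚᵘ (+ a) 0 ℚᵘ.* mkℚᵘ (+ b) 0
    pos-* = *≡* (cong (ℤ._* + 1) (ℤ.pos-* a b))

  ℕtoℚ-mono-< : ∀ {a b} → a ℕ.< b → ℕtoℚ a < ℕtoℚ b
  ℕtoℚ-mono-< {a} {b} a<b = toℚᵘ-cancel-< (ℚᵘ.<-respˡ-≃ (ℚᵘ.≃-sym (toℚᵘ-ℕtoℚ a))
    (ℚᵘ.<-respʳ-≃ (ℚᵘ.≃-sym (toℚᵘ-ℕtoℚ b)) (*<* (subst₂ ℤ._<_ (sym (ℤ.*-identityʳ (+ a))) (sym (ℤ.*-identityʳ (+ b))) (ℤ.+<+ a<b)))))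

  ℕtoℚ-mono-≤ : ∀ {a b} → a ℕ.≤ b → ℕtoℚ a ≤ ℕtoℚ b
  ℕtoℚ-mono-≤ {a} {b} a≤b = toℚᵘ-cancel-≤ (ℚᵘ.≤-respˡ-≃ (ℚᵘ.≃-sym (toℚᵘ-ℕtoℚ a))
    (ℚᵘ.≤-respʳ-≃ (ℚᵘ.≃-sym (toℚᵘ-ℕtoℚ b)) (*≤* (subst₂ ℤ._≤_ (sym (ℤ.*-identityʳ (+ a))) (sym (ℤ.*-identityʳ (+ b))) (ℤ.+≤+ a≤b)))))

  /-*-cancel : ∀ (z : ℤ) q .{{_ : ℕ.NonZero q}} → (z / q) * ℕtoℚ q ≡ z / 1
  /-*-cancel z (suc q) = toℚᵘ-injective (ℚᵘ.≃-trans (toℚᵘ-homo-* (z / suc q) (ℕtoℚ (suc q)))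
    (ℚᵘ.≃-trans (ℚᵘ.*-cong (toℚᵘ-fromℚᵘ (mkℚᵘ z q)) (toℚᵘ-ℕtoℚ (suc q)))
      (ℚᵘ.≃-trans (*≡* (trans (ℤ.*-identityʳ _) (cong (λ n → z ℤ.* + suc n) (sym (ℕ.*-identityʳ q)))))
        (ℚᵘ.≃-sym (toℚᵘ-fromℚᵘ (mkℚᵘ z 0))))))

  ÷₀-*-cancel : ∀ x {q} → 0ℚ < q → (x ÷₀ q) * q ≡ x
  ÷₀-*-cancel x {mkℚ (+ zero) _ _}      (*<* (ℤ.+<+ ()))
  ÷₀-*-cancel x {q@(mkℚ +[1+ _ ] _ _)} _ = trans (*-assoc x (1/ q) q) (trans (cong (x *_) (*-inverseˡ q)) (*-identityʳ x))
  ÷₀-*-cancel x {mkℚ -[1+ _ ] _ _}      (*<* ())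

  *-cancelʳ-≡-pos : ∀ {x y z} → 0ℚ < z → x * z ≡ y * z → x ≡ y
  *-cancelʳ-≡-pos {z = z} z>0 eq =
    ≤-antisym (*-cancelʳ-≤-pos z (≤-reflexive eq)) (*-cancelʳ-≤-pos z (≤-reflexive (sym eq)))
    where instance _ = positive z>0

  d*4^m≡dNum : ∀ m i → d m i * ℕtoℚ (2 ℕ.^ (2 ℕ.* m)) ≡ ℕtoℚ (dNum m i)
  d*4^m≡dNum m i = /-*-cancel (+ dNum m i) (2 ℕ.^ (2 ℕ.* m)) {{ℕ.m^n≢0 2 (2 ℕ.* m)}}

  d-pos : ∀ m i → 0 ℕ.< dNum m i → 0ℚ < d m i
  d-pos m i dNum>0 = *-cancelʳ-<-nonNeg (ℕtoℚ 4^m) {{normalize-nonNeg 4^m 1}}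
    (subst₂ _<_ (sym (*-zeroˡ (ℕtoℚ 4^m))) (sym (d*4^m≡dNum m i)) (ℕtoℚ-mono-< dNum>0))
    where 4^m = 2 ℕ.^ (2 ℕ.* m)

  ratio*4dNum≡dNum : ∀ m i → 0 ℕ.< dNum m i → ratio m i * ℕtoℚ (4 ℕ.* dNum m i) ≡ ℕtoℚ (dNum (suc m) i)
  ratio*4dNum≡dNum m i dNum>0 = begin
    ratio m i * ℕtoℚ (4 ℕ.* dNum m i)                ≡⟨ cong (ratio m i *_) (trans (ℕtoℚ-homo-* 4 (dNum m i))
                                                                    (cong (ℕtoℚ 4 *_) (sym (d*4^m≡dNum m i)))) ⟩
    ratio m i * (ℕtoℚ 4 * (d m i * ℕtoℚ 4^m))        ≡⟨ regroup (ratio m i) (ℕtoℚ 4) (d m i) (ℕtoℚ 4^m) ⟩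
    ratio m i * d m i * (ℕtoℚ 4 * ℕtoℚ 4^m)          ≡⟨ cong₂ _*_ (÷₀-*-cancel (d (suc m) i) (d-pos m i dNum>0))
                                                              (sym (ℕtoℚ-homo-* 4 4^m)) ⟩
    d (suc m) i * ℕtoℚ (4 ℕ.* 4^m)                   ≡⟨ cong (λ n → d (suc m) i * ℕtoℚ n) 4^[1+m]≡4*4^m ⟨
    d (suc m) i * ℕtoℚ (2 ℕ.^ (2 ℕ.* suc m))         ≡⟨ d*4^m≡dNum (suc m) i ⟩
    ℕtoℚ (dNum (suc m) i)                            ∎
    where
    open ≡-Reasoning
    open +-*-Solver
    4^m = 2 ℕ.^ (2 ℕ.* m)
    4^[1+m]≡4*4^m : 2 ℕ.^ (2 ℕ.* suc m) ≡ 4 ℕ.* 4^m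
    4^[1+m]≡4*4^m = trans (cong (2 ℕ.^_) (ℕ.*-suc 2 m)) (sym (ℕ.*-assoc 2 2 4^m))
    regroup : ∀ x f y p → x * (f * (y * p)) ≡ x * y * (f * p)
    regroup = solve 4 (λ x f y p → x :* (f :* (y :* p)) := x :* y :* (f :* p)) refl

  denominator-pos : ∀ m i → 0 ℕ.< denominator m i
  denominator-pos m i = ℕ.*-mono-< (ℕ.*-mono-< {0} {2} ℕ.z<s (0<+1 (m ℕ.∸ i))) (0<+1 m)
    where
    0<+1 : ∀ k → 0 ℕ.< k ℕ.+ 1
    0<+1 k = ℕ.<-≤-trans ℕ.z<s (ℕ.m≤n+m 1 k)

  x+y-y≡x : ∀ x y → x + y - y ≡ x
  x+y-y≡x = solve 2 (λ x y → x :+ y :- y := x) refl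
    where open +-*-Solver

  TAnum≡ : ∀ m i a → a ℕ.+ 2 ℕ.* i ℕ.* i ≡ 4 ℕ.* m ℕ.* m ℕ.+ 7 ℕ.* m ℕ.+ 3 → TAnum m i ≡ ℕtoℚ a
  TAnum≡ m i a a+2i²≡ = begin
    ℕtoℚ (4 ℕ.* m ℕ.* m ℕ.+ 7 ℕ.* m ℕ.+ 3) - ℕtoℚ (2 ℕ.* i ℕ.* i)
      ≡⟨ cong (_- ℕtoℚ (2 ℕ.* i ℕ.* i)) (trans (cong ℕtoℚ (sym a+2i²≡)) (ℕtoℚ-homo-+ a (2 ℕ.* i ℕ.* i))) ⟩
    ℕtoℚ a + ℕtoℚ (2 ℕ.* i ℕ.* i) - ℕtoℚ (2 ℕ.* i ℕ.* i)  ≡⟨ x+y-y≡x (ℕtoℚ a) (ℕtoℚ (2 ℕ.* i ℕ.* i)) ⟩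
    ℕtoℚ a                                              ∎
    where open ≡-Reasoning

  ratio-excess : ∀ m i u a → 0 ℕ.< dNum m i →
    denominator m i ℕ.* dNum (suc m) i ≡ u ℕ.+ 4 ℕ.* a ℕ.* dNum m i →
    a ℕ.+ 2 ℕ.* i ℕ.* i ≡ 4 ℕ.* m ℕ.* m ℕ.+ 7 ℕ.* m ℕ.+ 3 →
    (ratio m i - TA m i) * ℕtoℚ (4 ℕ.* dNum m i ℕ.* denominator m i) ≡ ℕtoℚ u
  ratio-excess m i u a dNum>0 excess a+2i²≡ = begin
    (ratio m i - TA m i) * ℕtoℚ (4 ℕ.* dNum m i ℕ.* b)   ≡⟨ cong ((ratio m i - TA m i) *_) (ℕtoℚ-homo-* (4 ℕ.* dNum m i) b) ⟩
    (ratio m i - TA m i) * (ℕtoℚ (4 ℕ.* dNum m i) * ℕtoℚ b)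
      ≡⟨ expand (ratio m i) (TA m i) (ℕtoℚ (4 ℕ.* dNum m i)) (ℕtoℚ b) ⟩
    ratio m i * ℕtoℚ (4 ℕ.* dNum m i) * ℕtoℚ b - TA m i * ℕtoℚ b * ℕtoℚ (4 ℕ.* dNum m i)
      ≡⟨ cong₂ (λ x y → x * ℕtoℚ b - y * ℕtoℚ (4 ℕ.* dNum m i))
               (ratio*4dNum≡dNum m i dNum>0) (trans (÷₀-*-cancel (TAnum m i) (ℕtoℚ-mono-< (denominator-pos m i))) (TAnum≡ m i a a+2i²≡)) ⟩
    ℕtoℚ (dNum (suc m) i) * ℕtoℚ b - ℕtoℚ a * ℕtoℚ (4 ℕ.* dNum m i)
      ≡⟨ cong₂ _-_ (trans (sym (ℕtoℚ-homo-* (dNum (suc m) i) b))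
                          (cong ℕtoℚ (trans (ℕ.*-comm (dNum (suc m) i) b) excess)))
                   (sym (ℕtoℚ-homo-* a (4 ℕ.* dNum m i))) ⟩
    ℕtoℚ (u ℕ.+ 4 ℕ.* a ℕ.* dNum m i) - ℕtoℚ (a ℕ.* (4 ℕ.* dNum m i))
      ≡⟨ cong₂ (λ x y → x - ℕtoℚ y) (ℕtoℚ-homo-+ u (4 ℕ.* a ℕ.* dNum m i)) (sym (4*a*n≡a*[4*n] a (dNum m i))) ⟩
    ℕtoℚ u + ℕtoℚ (4 ℕ.* a ℕ.* dNum m i) - ℕtoℚ (4 ℕ.* a ℕ.* dNum m i)  ≡⟨ x+y-y≡x (ℕtoℚ u) (ℕtoℚ (4 ℕ.* a ℕ.* dNum m i)) ⟩
    ℕtoℚ u                                               ∎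
    where
    open ≡-Reasoning
    open +-*-Solver
    b = denominator m i
    expand : ∀ x a f b → (x - a) * (f * b) ≡ x * f * b - a * b * f
    expand = solve 4 (λ x a f b → (x :- a) :* (f :* b)
                                := x :* f :* b :- a :* b :* f) refl
    4*a*n≡a*[4*n] : ∀ a n → 4 ℕ.* a ℕ.* n ≡ a ℕ.* (4 ℕ.* n)
    4*a*n≡a*[4*n] a n = ℕ-solve (a ∷ n ∷ [])

  square-scaled : ∀ y z u → y * ℕtoℚ z ≡ ℕtoℚ u → y * y * ℕtoℚ (z ℕ.* z) ≡ ℕtoℚ (u ℕ.* u)
  square-scaled y z u yz≡u = begin
    y * y * ℕtoℚ (z ℕ.* z)        ≡⟨ cong (y * y *_) (ℕtoℚ-homo-* z z) ⟩
    y * y * (ℕtoℚ z * ℕtoℚ z)     ≡⟨ regroup y (ℕtoℚ z) ⟩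
    y * ℕtoℚ z * (y * ℕtoℚ z)     ≡⟨ cong₂ _*_ yz≡u yz≡u ⟩
    ℕtoℚ u * ℕtoℚ u               ≡⟨ ℕtoℚ-homo-* u u ⟨
    ℕtoℚ (u ℕ.* u)                ∎
    where
    open ≡-Reasoning
    open +-*-Solver
    regroup : ∀ y z → y * y * (z * z) ≡ y * z * (y * z)
    regroup = solve 2 (λ y z → y :* y :* (z :* z) := y :* z :* (y :* z)) refl

  TB²D-scaled : ∀ m i n → let z = 4 ℕ.* n ℕ.* denominator m i in
    TB m i * TB m i * ℕtoℚ (TD m i) * ℕtoℚ (z ℕ.* z) ≡ ℕtoℚ (16 ℕ.* i ℕ.* i ℕ.* TD m i ℕ.* (n ℕ.* n))
  TB²D-scaled m i n = begin
    b * b * ℕtoℚ D * ℕtoℚ (z ℕ.* z)                             ≡⟨ cong (b * b * ℕtoℚ D *_)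
                                                                     (trans (cong ℕtoℚ (z²≡ (denominator m i) n))
                                                                            (ℕtoℚ-homo-* (B ℕ.* B) (16 ℕ.* (n ℕ.* n)))) ⟩
    b * b * ℕtoℚ D * (ℕtoℚ (B ℕ.* B) * ℕtoℚ (16 ℕ.* (n ℕ.* n))) ≡⟨ regroup b (ℕtoℚ D) (ℕtoℚ (B ℕ.* B)) (ℕtoℚ (16 ℕ.* (n ℕ.* n))) ⟩
    b * b * ℕtoℚ (B ℕ.* B) * (ℕtoℚ D * ℕtoℚ (16 ℕ.* (n ℕ.* n)))
      ≡⟨ cong₂ _*_ (square-scaled b B i (÷₀-*-cancel (ℕtoℚ i) (ℕtoℚ-mono-< (denominator-pos m i))))
                   (sym (ℕtoℚ-homo-* D (16 ℕ.* (n ℕ.* n)))) ⟩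
    ℕtoℚ (i ℕ.* i) * ℕtoℚ (D ℕ.* (16 ℕ.* (n ℕ.* n)))             ≡⟨ ℕtoℚ-homo-* (i ℕ.* i) (D ℕ.* (16 ℕ.* (n ℕ.* n))) ⟨
    ℕtoℚ (i ℕ.* i ℕ.* (D ℕ.* (16 ℕ.* (n ℕ.* n))))                ≡⟨ cong ℕtoℚ (reorder i D n) ⟩
    ℕtoℚ (16 ℕ.* i ℕ.* i ℕ.* D ℕ.* (n ℕ.* n))                    ∎
    where
    open ≡-Reasoning
    open +-*-Solver
    b = TB m i
    B = denominator m i
    D = TD m i
    z = 4 ℕ.* n ℕ.* B
    z²≡ : ∀ B n → 4 ℕ.* n ℕ.* B ℕ.* (4 ℕ.* n ℕ.* B) ≡ B ℕ.* B ℕ.* (16 ℕ.* (n ℕ.* n))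
    z²≡ B n = ℕ-solve (B ∷ n ∷ [])
    reorder : ∀ i D n → i ℕ.* i ℕ.* (D ℕ.* (16 ℕ.* (n ℕ.* n))) ≡ 16 ℕ.* i ℕ.* i ℕ.* D ℕ.* (n ℕ.* n)
    reorder i D n = ℕ-solve (i ∷ D ∷ n ∷ [])
    regroup : ∀ b d c e → b * b * d * (c * e) ≡ b * b * c * (d * e)
    regroup = solve 4 (λ b d c e → b :* b :* d :* (c :* e)
                        := b :* b :* c :* (d :* e)) refl

  module _ (m i u a : ℕ) (dNum>0 : 0 ℕ.< dNum m i)
           (excess : denominator m i ℕ.* dNum (suc m) i ≡ u ℕ.+ 4 ℕ.* a ℕ.* dNum m i)
           (a+2i²≡ : a ℕ.+ 2 ℕ.* i ℕ.* i ≡ 4 ℕ.* m ℕ.* m ℕ.+ 7 ℕ.* m ℕ.+ 3) where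

    private
      z = 4 ℕ.* dNum m i ℕ.* denominator m i
      z>0 : 0 ℕ.< z
      z>0 = ℕ.*-mono-< (ℕ.*-mono-< {0} {4} ℕ.z<s dNum>0) (denominator-pos m i)
      instance
        z²-nonNeg : NonNegative (ℕtoℚ (z ℕ.* z))
        z²-nonNeg = normalize-nonNeg (z ℕ.* z) 1
      y = ratio m i - TA m i
      y*z≡u : y * ℕtoℚ z ≡ ℕtoℚ u
      y*z≡u = ratio-excess m i u a dNum>0 excess a+2i²≡
      y²z²≡u² : y * y * ℕtoℚ (z ℕ.* z) ≡ ℕtoℚ (u ℕ.* u)
      y²z²≡u² = square-scaled y z u y*z≡u

    ratio-below : u ℕ.* u ℕ.< 16 ℕ.* i ℕ.* i ℕ.* TD m i ℕ.* (dNum m i ℕ.* dNum m i) →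
                  ratio m i <Surd[ TA m i + TB m i √ TD m i ]
    ratio-below u²< = inj₂ (*-cancelʳ-<-nonNeg (ℕtoℚ (z ℕ.* z))
      (subst₂ _<_ (sym y²z²≡u²) (sym (TB²D-scaled m i (dNum m i))) (ℕtoℚ-mono-< u²<)))

    ratio-on : u ℕ.* u ≡ 16 ℕ.* i ℕ.* i ℕ.* TD m i ℕ.* (dNum m i ℕ.* dNum m i) →
               ratio m i ≡Surd[ TA m i + TB m i √ TD m i ]
    ratio-on u²≡ = y≥0 , *-cancelʳ-≡-pos (ℕtoℚ-mono-< (ℕ.*-mono-< z>0 z>0))
      (trans y²z²≡u² (trans (cong ℕtoℚ u²≡) (sym (TB²D-scaled m i (dNum m i)))))
      where
      instance _ = positive (ℕtoℚ-mono-< z>0)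
      y≥0 : 0ℚ ≤ y
      y≥0 = *-cancelʳ-≤-pos (ℕtoℚ z)
        (subst₂ _≤_ (sym (*-zeroˡ (ℕtoℚ z))) (sym y*z≡u) (ℕtoℚ-mono-≤ {0} {u} z≤n))

  ratio-zero : ∀ m → ratio m 0 ≡Surd[ TA m 0 + TB m 0 √ TD m 0 ]
  ratio-zero m = ratio-on m 0 0 a (dNum-pos {m} {0} z≤n) (dNum-excess-zero m) (ℕ.+-identityʳ a) refl
    where
    a = 4 ℕ.* m ℕ.* m ℕ.+ 7 ℕ.* m ℕ.+ 3

  ratio-diag : ∀ j → ratio (suc j) (suc j) ≡Surd[ TA (suc j) (suc j) + TB (suc j) (suc j) √ TD (suc j) (suc j) ]
  ratio-diag j = ratio-on (suc j) (suc j) u (polyA j 0) (dNum-pos {suc j} {suc j} ℕ.≤-refl)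
    (trans (cong (ℕ._* dNum (2 ℕ.+ j) (suc j)) (sym (polyB≡denominator j 0))) excess) (polyA+2i² j 0) bound
    where open ExcessBound (excess-diag j)

  ratio-strict : ∀ j w → let m = 2 ℕ.+ w ℕ.+ j in ratio m (suc j) <Surd[ TA m (suc j) + TB m (suc j) √ TD m (suc j) ]
  ratio-strict j w = ratio-below (2 ℕ.+ w ℕ.+ j) (suc j) u (polyA j (suc w))
    (dNum-pos {2 ℕ.+ w ℕ.+ j} {suc j} (s≤s (ℕ.m≤n+m j (suc w))))
    (trans (cong (ℕ._* dNum (3 ℕ.+ w ℕ.+ j) (suc j)) (sym (polyB≡denominator j (suc w)))) excess)
    (polyA+2i² j (suc w)) bound
    where open ExcessBound (excess-bound-step j w (excess-bound j w))

open import Data.Nat using (ℕ; _≤_; _∸_; suc)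
open import Data.Nat.Properties using (m≤n⇒∃[o]m+o≡n; +-comm)
open import Data.Product using (_×_; _,_)
open import Relation.Binary.PropositionalEquality using (subst; cong; trans)
open Ratios using (ratio-strict; ratio-zero; ratio-diag)

theorem2p1 : ((m i : ℕ) → 2 ≤ m → 1 ≤ i → i ≤ m ∸ 1 →
               ratio m i <Surd[ TA m i + TB m i √ TD m i ])
             × ((m : ℕ) → 1 ≤ m →
               (ratio m 0 ≡Surd[ TA m 0 + TB m 0 √ TD m 0 ])
               × (ratio m m ≡Surd[ TA m m + TB m m √ TD m m ]))
theorem2p1 = interior , boundary
  where
  interior : (m i : ℕ) → 2 ≤ m → 1 ≤ i → i ≤ m ∸ 1 → ratio m i <Surd[ TA m i + TB m i √ TD m i ]
  interior (suc m) (suc j) _ _ i≤m =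
    let w , j+w≡m = m≤n⇒∃[o]m+o≡n i≤m
    in subst (λ n → ratio n (suc j) <Surd[ TA n (suc j) + TB n (suc j) √ TD n (suc j) ])
             (cong suc (trans (cong suc (+-comm w j)) j+w≡m)) (ratio-strict j w)
  boundary : (m : ℕ) → 1 ≤ m → (ratio m 0 ≡Surd[ TA m 0 + TB m 0 √ TD m 0 ])
                                × (ratio m m ≡Surd[ TA m m + TB m m √ TD m m ])
  boundary (suc j) _ = ratio-zero (suc j) , ratio-diag j
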